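{- Let $s\ge1$ be an integer. For every integer $m$ let $T_{m,s}=\sum_{k}\binom{m-1-k}{k}_{[s]}$ (sum over all integers $k$), so that $T_{m,s}=0$ for $m\le 0$ and $T_{1,s}=1$. Then for all integers $n\ge 1$, $$T_{n+1,s}=T_{n,s}+T_{n-1,s}+\cdots+T_{n-s,s}.$$
   Context: For integers $n,k$ with $0\le k\le n$, $\binom{n}{k}_{[s]}$ is the number of lattice paths from $(0,0)$ to $(n,k)$ using steps from $\{(1,0),(1,1),(2,1),\ldots,(s,1)\}$; for all other integer pairs it is $0$. Thus $T_{n+1,s}$ is the sum of the entries of the quasi $s$-Pascal triangle along the $n$-th diagonal ray (the $s$-bonacci sequence). -}

module Defs where

open import Data.Nat using (ℕ; zero; suc; _+_; _≤_; _≟_; _≤?_; _⊔_; _⊓_)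
open import Data.Nat.Properties using (≤-refl)
open import Data.Integer as ℤ using (ℤ; +_; -[1+_]; ∣_∣)
open import Data.List using (List; []; _∷_; length; filter; map; concatMap; upTo)
open import Data.Nat.ListAction using (sum)
open import Data.Product using (_×_; _,_)
open import Relation.Nullary using (Dec; yes; no)
open import Relation.Nullary.Decidable using (_×-dec_)
open import Relation.Binary.PropositionalEquality using (_≡_)

-- A step is coded by j ∈ {0,…,s}: j = 0 is the step (1,0), j ≥ 1 is the step (j,1).
stepDx : ℕ → ℕ
stepDx j = j ⊔ 1

stepDy : ℕ → ℕ
stepDy j = j ⊓ 1

steps : ℕ → List ℕ
steps s = upTo (suc s)

pathsUpTo : ℕ → ℕ → List (List ℕ)
pathsUpTo s zero = [] ∷ []
pathsUpTo s (suc fuel) =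
  [] ∷ concatMap (λ j → map (j ∷_) (pathsUpTo s fuel)) (steps s)

endX : List ℕ → ℕ
endX [] = 0
endX (j ∷ p) = stepDx j + endX p

endY : List ℕ → ℕ
endY [] = 0
endY (j ∷ p) = stepDy j + endY p

endsAt : (n k : ℕ) (p : List ℕ) → Dec ((endX p ≡ n) × (endY p ≡ k))
endsAt n k p = (endX p ≟ n) ×-dec (endY p ≟ k)

-- Every path to (n,k) has at most n steps (each step has width ≥ 1), so
-- enumerating step sequences of length ≤ n lists every such path exactly once.
-- binomS s n k = number of lattice paths (0,0) → (n,k) with steps
-- {(1,0),(1,1),(2,1),…,(s,1)}  (0 when k > n automatically).
binomS : ℕ → ℕ → ℕ → ℕ
binomS s n k = length (filter (endsAt n k) (pathsUpTo s n))

binomZ : ℕ → ℤ → ℤ → ℕ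
binomZ s (+ n) (+ k) with k ≤? n
... | yes _ = binomS s n k
... | no _ = 0
binomZ s _ _ = 0

-- T m s = Σ_{k ∈ ℤ} binomZ s (m-1-k) k.  Terms with k < 0 vanish, and terms with
-- k > ∣m∣ vanish (they would need 0 ≤ k ≤ m-1-k), so the sum over k = 0,…,∣m∣ is the full sum.
T : ℤ → ℕ → ℕ
T m s = sum (map (λ k → binomZ s (m ℤ.- + 1 ℤ.- + k) (+ k)) (upTo (suc ∣ m ∣)))

sumRange : ℕ → (ℕ → ℕ) → ℕ
sumRange zero f = f 0
sumRange (suc s) f = sumRange s f + f (suc s)

{-# OPTIONS --safe #-}
-- A path is its list of step codes, and the step coded j raises x + y by exactly j + 1. Summing
-- the quasi s-Pascal entries over the diagonal ray therefore shows that T(a+1) counts the paths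
-- ending on the line x + y = a; classifying these by their first step j gives
-- T(n+1) = Σ_{j ≤ s} T(n-j), where a first step j ≥ n is impossible, matching T(n-j) = 0 for
-- n - j ≤ 0. Each step advances x, so enumerations of step lists of length ≤ F all see the
-- same paths to points with x ≤ F, which lets every count be taken in a single enumeration.
module Submission where

open import Defs
open import Data.Nat using (ℕ; zero; suc; _+_; _∸_; _≤_; _≰_; _<_; _≤′_; _≤?_; _<?_; _≟_; z≤n; s≤s; s≤s⁻¹; ≤′-refl; ≤′-step)
open import Data.Nat.Properties
open import Data.Integer using (+_; -[1+_]; -_; _-_; _⊖_)
open import Data.Integer.Properties using (m-n≡m⊖n; ⊖-≥; ⊖-≤; ⊖-<)
open import Data.List using (List; []; _∷_; _++_; length; filter; map; concatMap; applyUpTo; upTo)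
open import Data.List.Properties using (length-++; filter-++; filter-≐; filter-none; map-upTo; applyUpTo-∷ʳ)
open import Data.List.Relation.Unary.All using (universal)
open import Data.Nat.ListAction using (sum)
open import Data.Nat.ListAction.Properties using (sum-++)
open import Data.Product using (_×_; _,_; proj₂)
open import Data.Bool using (true; false)
open import Function using (_∘_)
open import Level using (Level)
open import Relation.Nullary using (¬_; yes; no; does; contradiction)
open import Relation.Nullary.Decidable using (_×-dec_)
open import Relation.Unary using (Pred; Decidable; _≐_)
open import Relation.Unary.Properties using (_∩?_; ∁?)
open import Relation.Binary.PropositionalEquality
open import Algebra.Properties.CommutativeSemigroup +-commutativeSemigroup using (interchange)

sum-applyUpTo-cong : ∀ {f g : ℕ → ℕ} → (∀ k → f k ≡ g k) → ∀ n → sum (applyUpTo f n) ≡ sum (applyUpTo g n)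
sum-applyUpTo-cong f≗g zero = refl
sum-applyUpTo-cong f≗g (suc n) = cong₂ _+_ (f≗g 0) (sum-applyUpTo-cong (f≗g ∘ suc) n)

sum-applyUpTo-zero : ∀ {f : ℕ → ℕ} → (∀ k → f k ≡ 0) → ∀ n → sum (applyUpTo f n) ≡ 0
sum-applyUpTo-zero f≗0 zero = refl
sum-applyUpTo-zero f≗0 (suc n) = cong₂ _+_ (f≗0 0) (sum-applyUpTo-zero (f≗0 ∘ suc) n)

sum-applyUpTo-suc : ∀ (f : ℕ → ℕ) n → sum (applyUpTo f (suc n)) ≡ sum (applyUpTo f n) + f n
sum-applyUpTo-suc f n = begin
  sum (applyUpTo f (suc n))           ≡⟨ cong sum (applyUpTo-∷ʳ f n) ⟨
  sum (applyUpTo f n ++ f n ∷ [])     ≡⟨ sum-++ (applyUpTo f n) (f n ∷ []) ⟩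
  sum (applyUpTo f n) + (f n + 0)     ≡⟨ cong (λ m → sum (applyUpTo f n) + m) (+-identityʳ (f n)) ⟩
  sum (applyUpTo f n) + f n           ∎
  where open ≡-Reasoning

sumRange≡sum-applyUpTo : ∀ s (f : ℕ → ℕ) → sumRange s f ≡ sum (applyUpTo f (suc s))
sumRange≡sum-applyUpTo zero f = sym (+-identityʳ (f 0))
sumRange≡sum-applyUpTo (suc s) f =
  trans (cong (_+ f (suc s)) (sumRange≡sum-applyUpTo s f)) (sym (sum-applyUpTo-suc f (suc s)))

count : ∀ {a p} {A : Set a} {P : Pred A p} → Decidable P → List A → ℕ
count P? xs = length (filter P? xs)

module _ {a : Level} {A : Set a} where

  module _ {p} {P : Pred A p} (P? : Decidable P) where

    count-++ : ∀ xs ys → count P? (xs ++ ys) ≡ count P? xs + count P? ys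
    count-++ xs ys = trans (cong length (filter-++ P? xs ys)) (length-++ (filter P? xs))

    count-concatMap : ∀ {b} {B : Set b} (f : B → List A) xs → count P? (concatMap f xs) ≡ sum (map (count P? ∘ f) xs)
    count-concatMap f [] = refl
    count-concatMap f (x ∷ xs) =
      trans (count-++ (f x) (concatMap f xs)) (cong (λ m → count P? (f x) + m) (count-concatMap f xs))

    count-map : ∀ {b} {B : Set b} (f : B → A) xs → count P? (map f xs) ≡ count (λ y → P? (f y)) xs
    count-map f [] = refl
    count-map f (x ∷ xs) with does (P? (f x))
    ... | true = cong suc (count-map f xs)
    ... | false = count-map f xs

    count-none : (∀ x → ¬ P x) → ∀ xs → count P? xs ≡ 0
    count-none ¬P xs = cong length (filter-none P? (universal ¬P xs))

    count-cong : ∀ {q} {Q : Pred A q} (Q? : Decidable Q) → P ≐ Q → ∀ xs → count P? xs ≡ count Q? xs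
    count-cong Q? P≐Q xs = cong length (filter-≐ P? Q? P≐Q xs)

    count-split : ∀ {q} {Q : Pred A q} (Q? : Decidable Q) → ∀ xs →
      count P? xs ≡ count (P? ∩? Q?) xs + count (P? ∩? ∁? Q?) xs
    count-split Q? [] = refl
    count-split Q? (x ∷ xs) with does (P? x) | does (Q? x)
    ... | true | true = cong suc (count-split Q? xs)
    ... | true | false = trans (cong suc (count-split Q? xs)) (sym (+-suc _ _))
    ... | false | true = count-split Q? xs
    ... | false | false = count-split Q? xs

  count-fibres : (f : A → ℕ) {p : Level} {P : Pred A p} (P? : Decidable P) (xs : List A) → ∀ n →
    sum (applyUpTo (λ k → count (λ x → (f x ≟ k) ×-dec P? x) xs) n) ≡ count (λ x → (f x <? n) ×-dec P? x) xs
  count-fibres f P? xs zero = sym (count-none _ (λ x (f<0 , _) → n≮0 f<0) xs)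
  count-fibres f {P = P} P? xs (suc n) = begin
    sum (applyUpTo fibre (suc n))                                  ≡⟨ sum-applyUpTo-suc fibre n ⟩
    sum (applyUpTo fibre n) + fibre n                              ≡⟨ cong (_+ fibre n) (count-fibres f P? xs n) ⟩
    count (below n) xs + fibre n                                   ≡⟨ cong₂ _+_ (count-cong (below n) _ below≐ xs)
                                                                                (count-cong (λ x → (f x ≟ n) ×-dec P? x) _ at≐ xs) ⟩
    count (below (suc n) ∩? f<n?) xs + count (below (suc n) ∩? ∁? f<n?) xs ≡⟨ count-split (below (suc n)) f<n? xs ⟨
    count (below (suc n)) xs                                       ∎
    where
    open ≡-Reasoning
    fibre : ℕ → ℕ
    fibre k = count (λ x → (f x ≟ k) ×-dec P? x) xs
    below : ∀ k → Decidable (λ x → f x < k × P x)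
    below k x = (f x <? k) ×-dec P? x
    f<n? : Decidable (λ x → f x < n)
    f<n? x = f x <? n
    below≐ : (λ x → f x < n × P x) ≐ (λ x → (f x < suc n × P x) × f x < n)
    below≐ = (λ {_} (lt , p) → (m<n⇒m<1+n lt , p) , lt) , (λ {_} ((_ , p) , lt) → lt , p)
    at≐ : (λ x → f x ≡ n × P x) ≐ (λ x → (f x < suc n × P x) × ¬ f x < n)
    at≐ = (λ { {x} (refl , p) → (n<1+n (f x) , p) , n≮n (f x) })
        , (λ {_} ((lt , p) , ¬lt) → ≤∧≮⇒≡ (s≤s⁻¹ lt) ¬lt , p)

weight : List ℕ → ℕ
weight p = endX p + endY p

stepDx+stepDy≡suc : ∀ j → stepDx j + stepDy j ≡ suc j
stepDx+stepDy≡suc zero = refl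
stepDx+stepDy≡suc (suc j) = trans (cong₂ (λ x y → suc x + suc y) (⊔-identityʳ j) (⊓-zeroʳ j)) (+-comm (suc j) 1)

weight-∷ : ∀ j p → weight (j ∷ p) ≡ suc j + weight p
weight-∷ j p = trans (interchange (stepDx j) (endX p) (stepDy j) (endY p))
                     (cong (_+ weight p) (stepDx+stepDy≡suc j))

length≤endX : ∀ p → length p ≤ endX p
length≤endX [] = z≤n
length≤endX (zero ∷ p) = s≤s (length≤endX p)
length≤endX (suc j ∷ p) = +-mono-≤ (s≤s z≤n) (length≤endX p)

endY≤endX : ∀ p → endY p ≤ endX p
endY≤endX [] = z≤n
endY≤endX (j ∷ p) = +-mono-≤ (m⊓n≤m⊔n j 1) (endY≤endX p)

length≤weight : ∀ p → length p ≤ weight p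
length≤weight p = ≤-trans (length≤endX p) (m≤m+n (endX p) (endY p))

endY≤weight : ∀ p → endY p ≤ weight p
endY≤weight p = m≤n+m (endY p) (endX p)

m<n⇒m⊖n≡-[1+n∸1+m] : ∀ {m n} → m < n → m ⊖ n ≡ -[1+ n ∸ suc m ]
m<n⇒m⊖n≡-[1+n∸1+m] {n = suc n} (s≤s m≤n) = trans (⊖-< (s≤s m≤n)) (cong (-_ ∘ +_) (+-∸-assoc 1 m≤n))

module _ (s : ℕ) where

  count-pathsUpTo-suc : ∀ {p} {P : Pred (List ℕ) p} (P? : Decidable P) F →
    count P? (pathsUpTo s (suc F)) ≡
    count P? ([] ∷ []) + sum (applyUpTo (λ j → count (P? ∘ (j ∷_)) (pathsUpTo s F)) (suc s))
  count-pathsUpTo-suc P? F = begin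
    count P? (([] ∷ []) ++ concatMap extend (steps s))
      ≡⟨ count-++ P? ([] ∷ []) (concatMap extend (steps s)) ⟩
    count P? ([] ∷ []) + count P? (concatMap extend (steps s))
      ≡⟨ cong (λ m → count P? ([] ∷ []) + m) (begin
           count P? (concatMap extend (steps s))               ≡⟨ count-concatMap P? extend (steps s) ⟩
           sum (map (count P? ∘ extend) (upTo (suc s)))        ≡⟨ cong sum (map-upTo (count P? ∘ extend) (suc s)) ⟩
           sum (applyUpTo (count P? ∘ extend) (suc s))         ≡⟨ sum-applyUpTo-cong (λ j → count-map P? (j ∷_) (pathsUpTo s F)) (suc s) ⟩
           sum (applyUpTo (λ j → count (P? ∘ (j ∷_)) (pathsUpTo s F)) (suc s)) ∎) ⟩
    count P? ([] ∷ []) + sum (applyUpTo (λ j → count (P? ∘ (j ∷_)) (pathsUpTo s F)) (suc s)) ∎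
    where
    open ≡-Reasoning
    extend : ℕ → List (List ℕ)
    extend j = map (j ∷_) (pathsUpTo s F)

  count-pathsUpTo-suc-irrelevant : ∀ {p} {P : Pred (List ℕ) p} (P? : Decidable P) F →
    (∀ q → P q → length q ≤ F) → count P? (pathsUpTo s (suc F)) ≡ count P? (pathsUpTo s F)
  count-pathsUpTo-suc-irrelevant P? zero short = begin
    count P? (pathsUpTo s 1)                                               ≡⟨ count-pathsUpTo-suc P? 0 ⟩
    count P? ([] ∷ []) + sum (applyUpTo (λ j → count (P? ∘ (j ∷_)) ([] ∷ [])) (suc s))
      ≡⟨ cong (λ m → count P? ([] ∷ []) + m) (sum-applyUpTo-zero noSingleton (suc s)) ⟩
    count P? ([] ∷ []) + 0                                                 ≡⟨ +-identityʳ _ ⟩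
    count P? ([] ∷ [])                                                     ∎
    where
    open ≡-Reasoning
    noSingleton : ∀ j → count (P? ∘ (j ∷_)) ([] ∷ []) ≡ 0
    noSingleton j = count-none (P? ∘ (j ∷_)) (λ q Pjq → n≮0 (short (j ∷ q) Pjq)) ([] ∷ [])
  count-pathsUpTo-suc-irrelevant P? (suc F) short = begin
    count P? (pathsUpTo s (suc (suc F)))                                          ≡⟨ count-pathsUpTo-suc P? (suc F) ⟩
    count P? ([] ∷ []) + sum (applyUpTo (λ j → count (P? ∘ (j ∷_)) (pathsUpTo s (suc F))) (suc s))
      ≡⟨ cong (λ m → count P? ([] ∷ []) + m) (sum-applyUpTo-cong tails (suc s)) ⟩
    count P? ([] ∷ []) + sum (applyUpTo (λ j → count (P? ∘ (j ∷_)) (pathsUpTo s F)) (suc s))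
      ≡⟨ count-pathsUpTo-suc P? F ⟨
    count P? (pathsUpTo s (suc F))                                                ∎
    where
    open ≡-Reasoning
    tails : ∀ j → count (P? ∘ (j ∷_)) (pathsUpTo s (suc F)) ≡ count (P? ∘ (j ∷_)) (pathsUpTo s F)
    tails j = count-pathsUpTo-suc-irrelevant (P? ∘ (j ∷_)) F (λ q Pjq → s≤s⁻¹ (short (j ∷ q) Pjq))

  count-pathsUpTo-irrelevant : ∀ {p} {P : Pred (List ℕ) p} (P? : Decidable P) {F G} →
    (∀ q → P q → length q ≤ F) → F ≤ G → count P? (pathsUpTo s G) ≡ count P? (pathsUpTo s F)
  count-pathsUpTo-irrelevant P? {F} short F≤G = go (≤⇒≤′ F≤G)
    where
    go : ∀ {G} → F ≤′ G → count P? (pathsUpTo s G) ≡ count P? (pathsUpTo s F)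
    go ≤′-refl = refl
    go (≤′-step {G} F≤′G) =
      trans (count-pathsUpTo-suc-irrelevant P? G (λ q Pq → ≤-trans (short q Pq) (≤′⇒≤ F≤′G))) (go F≤′G)

  diagonalCount : ℕ → ℕ
  diagonalCount a = count (λ p → weight p ≟ a) (pathsUpTo s a)

  binomZ-+ : ∀ {n k} → k ≤ n → binomZ s (+ n) (+ k) ≡ binomS s n k
  binomZ-+ {n} {k} k≤n with k ≤? n
  ... | yes _ = refl
  ... | no k≰n = contradiction k≤n k≰n

  binomZ-+-≰ : ∀ {n k} → k ≰ n → binomZ s (+ n) (+ k) ≡ 0
  binomZ-+-≰ {n} {k} k≰n with k ≤? n
  ... | yes k≤n = contradiction k≤n k≰n
  ... | no _ = refl

  binomZ-⊖ : ∀ a k → binomZ s (a ⊖ k) (+ k) ≡ count (λ p → (endY p ≟ k) ×-dec (weight p ≟ a)) (pathsUpTo s a)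
  binomZ-⊖ a k with k ≤? a ∸ k
  ... | yes k≤a∸k = begin
    binomZ s (a ⊖ k) (+ k)                         ≡⟨ cong (λ z → binomZ s z (+ k)) (⊖-≥ k≤a) ⟩
    binomZ s (+ (a ∸ k)) (+ k)                     ≡⟨ binomZ-+ k≤a∸k ⟩
    count (endsAt (a ∸ k) k) (pathsUpTo s (a ∸ k)) ≡⟨ count-pathsUpTo-irrelevant (endsAt (a ∸ k) k) short (m∸n≤m a k) ⟨
    count (endsAt (a ∸ k) k) (pathsUpTo s a)       ≡⟨ count-cong (endsAt (a ∸ k) k) _ endsAt≐ (pathsUpTo s a) ⟩
    count (λ p → (endY p ≟ k) ×-dec (weight p ≟ a)) (pathsUpTo s a) ∎
    where
    open ≡-Reasoning
    k≤a : k ≤ a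
    k≤a = ≤-trans k≤a∸k (m∸n≤m a k)
    short : ∀ p → endX p ≡ a ∸ k × endY p ≡ k → length p ≤ a ∸ k
    short p (x≡ , _) = subst (length p ≤_) x≡ (length≤endX p)
    endsAt≐ : (λ p → endX p ≡ a ∸ k × endY p ≡ k) ≐ (λ p → endY p ≡ k × weight p ≡ a)
    endsAt≐ = (λ {_} (x≡ , y≡) → y≡ , trans (cong₂ _+_ x≡ y≡) (m∸n+n≡m k≤a))
            , (λ {p} (y≡ , w≡) → trans (sym (m+n∸n≡m (endX p) (endY p))) (cong₂ _∸_ w≡ y≡) , y≡)
  ... | no k≰a∸k = trans binomZ≡0 (sym (count-none _ noPath (pathsUpTo s a)))
    where
    noPath : ∀ p → ¬ (endY p ≡ k × weight p ≡ a)
    noPath p (refl , refl) = k≰a∸k (subst (endY p ≤_) (sym (m+n∸n≡m (endX p) (endY p))) (endY≤endX p))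
    binomZ≡0 : binomZ s (a ⊖ k) (+ k) ≡ 0
    binomZ≡0 with k ≤? a
    ... | yes k≤a = trans (cong (λ z → binomZ s z (+ k)) (⊖-≥ k≤a)) (binomZ-+-≰ k≰a∸k)
    ... | no k≰a = cong (λ z → binomZ s z (+ k)) (m<n⇒m⊖n≡-[1+n∸1+m] (≰⇒> k≰a))

  T-+suc : ∀ a → T (+ suc a) s ≡ diagonalCount a
  T-+suc a = begin
    T (+ suc a) s                                                    ≡⟨ cong sum (map-upTo term (suc (suc a))) ⟩
    sum (applyUpTo term (suc (suc a)))                               ≡⟨ sum-applyUpTo-cong diagonalTerm (suc (suc a)) ⟩
    sum (applyUpTo (λ k → count (fibre k) (pathsUpTo s a)) (suc (suc a)))
      ≡⟨ count-fibres endY (λ p → weight p ≟ a) (pathsUpTo s a) (suc (suc a)) ⟩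
    count (λ p → (endY p <? suc (suc a)) ×-dec (weight p ≟ a)) (pathsUpTo s a)
      ≡⟨ count-cong _ (λ p → weight p ≟ a) (proj₂ , λ {p} w≡ → low p w≡ , w≡) (pathsUpTo s a) ⟩
    diagonalCount a                                                  ∎
    where
    open ≡-Reasoning
    term : ℕ → ℕ
    term k = binomZ s (+ suc a - + 1 - + k) (+ k)
    fibre : ∀ k → Decidable (λ p → endY p ≡ k × weight p ≡ a)
    fibre k p = (endY p ≟ k) ×-dec (weight p ≟ a)
    low : ∀ p → weight p ≡ a → endY p < suc (suc a)
    low p w≡ = s≤s (≤-trans (endY≤weight p) (≤-trans (≤-reflexive w≡) (n≤1+n a)))
    diagonalTerm : ∀ k → term k ≡ count (fibre k) (pathsUpTo s a)
    diagonalTerm k = trans (cong (λ z → binomZ s z (+ k)) (m-n≡m⊖n a k)) (binomZ-⊖ a k)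

  T-nonpositive : ∀ t → T (- + t) s ≡ 0
  T-nonpositive zero = refl
  T-nonpositive (suc t) = trans (cong sum (map-upTo term (suc (suc t)))) (sum-applyUpTo-zero vanish (suc (suc t)))
    where
    term : ℕ → ℕ
    term k = binomZ s (-[1+ t ] - + 1 - + k) (+ k)
    vanish : ∀ k → term k ≡ 0
    vanish zero = refl
    vanish (suc k) = refl

  count-first-step : ∀ b j → count (λ p → weight (j ∷ p) ≟ suc b) (pathsUpTo s b) ≡ T (suc b ⊖ j) s
  count-first-step b j with j ≤? b
  ... | yes j≤b = begin
    count (λ p → weight (j ∷ p) ≟ suc b) (pathsUpTo s b)    ≡⟨ count-cong _ (λ p → weight p ≟ b ∸ j) rest≐ (pathsUpTo s b) ⟩
    count (λ p → weight p ≟ b ∸ j) (pathsUpTo s b)          ≡⟨ count-pathsUpTo-irrelevant _ short (m∸n≤m b j) ⟩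
    diagonalCount (b ∸ j)                                   ≡⟨ T-+suc (b ∸ j) ⟨
    T (+ suc (b ∸ j)) s                                     ≡⟨ cong (λ z → T z s) (trans (⊖-≥ (m≤n⇒m≤1+n j≤b)) (cong +_ (+-∸-assoc 1 j≤b))) ⟨
    T (suc b ⊖ j) s                                         ∎
    where
    open ≡-Reasoning
    short : ∀ p → weight p ≡ b ∸ j → length p ≤ b ∸ j
    short p w≡ = subst (length p ≤_) w≡ (length≤weight p)
    rest≐ : (λ p → weight (j ∷ p) ≡ suc b) ≐ (λ p → weight p ≡ b ∸ j)
    rest≐ = (λ {p} w≡ → trans (sym (m+n∸m≡n j (weight p))) (cong (_∸ j) (suc-injective (trans (sym (weight-∷ j p)) w≡))))
          , (λ {p} w≡ → trans (weight-∷ j p) (cong suc (trans (cong (λ w → j + w) w≡) (m+[n∸m]≡n j≤b))))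
  ... | no j≰b = trans (count-none _ tooLong (pathsUpTo s b))
                       (sym (trans (cong (λ z → T z s) (⊖-≤ (≰⇒> j≰b))) (T-nonpositive (j ∸ suc b))))
    where
    tooLong : ∀ p → weight (j ∷ p) ≢ suc b
    tooLong p w≡ = j≰b (subst (j ≤_) (suc-injective (trans (sym (weight-∷ j p)) w≡)) (m≤m+n j (weight p)))

  diagonalCount-suc : ∀ b → diagonalCount (suc b) ≡ sum (applyUpTo (λ j → T (suc b ⊖ j) s) (suc s))
  diagonalCount-suc b = trans (count-pathsUpTo-suc (λ p → weight p ≟ suc b) b)
                              (sum-applyUpTo-cong (count-first-step b) (suc s))

-- The identity also holds for s = 0.
mainTheorem5 : (s n : ℕ) → 1 ≤ s → 1 ≤ n →
    T (+ (n + 1)) s ≡ sumRange s (λ i → T (+ n - + i) s)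
mainTheorem5 s (suc b) _ _ = begin
  T (+ (suc b + 1)) s                                  ≡⟨ cong (λ m → T (+ m) s) (+-comm (suc b) 1) ⟩
  T (+ suc (suc b)) s                                  ≡⟨ T-+suc s (suc b) ⟩
  diagonalCount s (suc b)                              ≡⟨ diagonalCount-suc s b ⟩
  sum (applyUpTo (λ j → T (suc b ⊖ j) s) (suc s))      ≡⟨ sum-applyUpTo-cong (λ j → cong (λ z → T z s) (m-n≡m⊖n (suc b) j)) (suc s) ⟨
  sum (applyUpTo (λ j → T (+ suc b - + j) s) (suc s))  ≡⟨ sumRange≡sum-applyUpTo s _ ⟨
  sumRange s (λ i → T (+ suc b - + i) s)               ∎
  where open ≡-Reasoning
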